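{- Every $11$-cap of dimension $7$ in $\mathbb{Z}_2^n$ has a basis of extended type $5\text{ - }5\text{ - }5\text{ - }(3,3,2)$.
   Context: Work in $\mathbb{Z}_2^n$. An affine combination of a set is a sum of an odd number of its distinct elements; $\operatorname{aff}(S)$ is the set of all affine combinations of elements of $S$, and the dimension of $S$ is the dimension of the affine flat $\operatorname{aff}(S)$. A basis for $S$ is a subset $B\subseteq S$ that is affinely independent (no element is an affine combination of the others) with $\operatorname{aff}(B)=\operatorname{aff}(S)$; its dependent set is $D=S\setminus B$. For $x\in D$, $B_x$ is the unique subset of $B$ whose elements sum to $x$. A quad is a set of four distinct elements summing to $\mathbf{0}$; a cap is a quad-free subset; a $k$-cap is a cap with $k$ elements. For $|D|=3$, a basis $B$ has extended type $n_1\text{ - }n_2\text{ - }n_3\text{ - }(m_{12},m_{13},m_{23})$ if the elements of $D$ can be labeled $x_1,x_2,x_3$ so that $|B_{x_i}|=n_i$ for each $i$ and $|B_{x_i}\cap B_{x_j}|=m_{ij}$ for all $i<j$. -}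

module Defs where

open import Data.Bool using (Bool; true; false; _xor_)
open import Data.Nat using (ℕ; zero; suc; _+_; _*_)
open import Data.Fin using (Fin; zero; suc)
open import Data.Fin.Subset using (Subset; _∈_; _∉_; _⊆_; _∩_; _-_; ∣_∣; ⊤)
open import Data.Vec using (Vec; []; _∷_; zipWith; replicate)
open import Data.Product using (Σ; ∃; _×_; _,_)
open import Relation.Binary.PropositionalEquality using (_≡_; _≢_)
open import Relation.Nullary using (¬_)
open import Function using (_⇔_)
open import Data.Sum using (_⊎_)
open import Function.Definitions using (Injective)

Point : ℕ → Set
Point n = Vec Bool n

𝟎 : ∀ {n} → Point n
𝟎 = replicate _ false

infixl 6 _⊕_
_⊕_ : ∀ {n} → Point n → Point n → Point n
_⊕_ = zipWith _xor_

Odd : ℕ → Set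
Odd m = ∃ λ j → m ≡ suc (2 * j)

sumOver : ∀ {n k} → (Fin k → Point n) → Subset k → Point n
sumOver {k = zero}  P []            = 𝟎
sumOver {k = suc k} P (true  ∷ T)   = P zero ⊕ sumOver (λ i → P (suc i)) T
sumOver {k = suc k} P (false ∷ T)   = sumOver (λ i → P (suc i)) T

-- A finite set S ⊆ Z_2^n with k elements is given as an injective family
-- S : Fin k → Point n; its subsets are index subsets U : Subset k.

-- x is an affine combination of the elements of S indexed by U
-- (sum of an odd number of distinct elements).
InAff : ∀ {n k} → (Fin k → Point n) → Subset k → Point n → Set
InAff S U x = Σ _ λ T → T ⊆ U × Odd ∣ T ∣ × sumOver S T ≡ x

AffIndep : ∀ {n k} → (Fin k → Point n) → Subset k → Set
AffIndep S U = ∀ i → i ∈ U → ¬ InAff S (U - i) (S i)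

SameAff : ∀ {n k l} → (Fin k → Point n) → Subset k → (Fin l → Point n) → Subset l → Set
SameAff {n} S U P V = (x : Point n) → InAff S U x ⇔ InAff P V x

-- S has dimension d: the affine flat aff(S) has dimension d, i.e. it has an
-- affine basis (affinely independent points of Z_2^n spanning it) of d+1 points.
HasDim : ∀ {n k} → (Fin k → Point n) → ℕ → Set
HasDim {n} S d = Σ (Fin (suc d) → Point n) λ P →
  Injective _≡_ _≡_ P × AffIndep P ⊤ × SameAff P ⊤ S ⊤

IsCap : ∀ {n k} → (Fin k → Point n) → Set
IsCap S = ∀ i j l m → i ≢ j → i ≢ l → i ≢ m → j ≢ l → j ≢ m → l ≢ m →
  S i ⊕ S j ⊕ S l ⊕ S m ≢ 𝟎

IsBasis : ∀ {n k} → (Fin k → Point n) → Subset k → Set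
IsBasis S B = AffIndep S B × SameAff S B S ⊤

-- T is B_x for the element S i: a subset of B whose elements sum to S i
-- (as an affine combination, i.e. |T| odd; unique when B is a basis).
IsBx : ∀ {n k} → (Fin k → Point n) → Subset k → Fin k → Subset k → Set
IsBx S B i T = T ⊆ B × Odd ∣ T ∣ × sumOver S T ≡ S i

-- B has extended type n1-n2-n3-(m12,m13,m23): D = S \ B = {x1,x2,x3}
-- (three distinct elements) with |B_{xi}| = ni, |B_{xi} ∩ B_{xj}| = mij.
HasExtType : ∀ {n k} → (Fin k → Point n) → Subset k →
  ℕ → ℕ → ℕ → ℕ → ℕ → ℕ → Set
HasExtType S B n₁ n₂ n₃ m₁₂ m₁₃ m₂₃ =
  Σ _ λ x₁ → Σ _ λ x₂ → Σ _ λ x₃ →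
    x₁ ∉ B × x₂ ∉ B × x₃ ∉ B × x₁ ≢ x₂ × x₁ ≢ x₃ × x₂ ≢ x₃ ×
    (∀ y → y ∉ B → (y ≡ x₁ ⊎ y ≡ x₂ ⊎ y ≡ x₃)) ×
    Σ _ λ T₁ → Σ _ λ T₂ → Σ _ λ T₃ →
      IsBx S B x₁ T₁ × IsBx S B x₂ T₂ × IsBx S B x₃ T₃ ×
      ∣ T₁ ∣ ≡ n₁ × ∣ T₂ ∣ ≡ n₂ × ∣ T₃ ∣ ≡ n₃ ×
      ∣ T₁ ∩ T₂ ∣ ≡ m₁₂ × ∣ T₁ ∩ T₃ ∣ ≡ m₁₃ × ∣ T₂ ∩ T₃ ∣ ≡ m₂₃

-- The affine relations of S (even subsets summing to 𝟎) form a vector space over ℤ₂.  As S lies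
-- in the 7-flat spanned by the 8 points P, any 9 of its points support a nonzero relation, which
-- yields three independent relations.  Since S is a cap, each of their 7 nonzero combinations has
-- at least 6 elements, and each element of their union lies in exactly 4 of them, so the sizes
-- add up to a multiple of 4 between 42 and 44: one combination has size 8, the others size 6.
-- Choosing generators C₁, C₂, C₃ with ∣C₂ ⊕ C₃∣ = 8, inclusion–exclusion gives points xᵢ lying in
-- Cᵢ only.  Then B = S ∖ {x₁, x₂, x₃} is a basis with B_{xᵢ} = Cᵢ ∖ {xᵢ}, of extended type
-- 5-5-5-(3,3,2).

module Submission where

open import Defs
open import Data.Bool using (Bool; true; false; not; _xor_; _∧_; _∨_)
open import Data.Bool.Properties
  using (xor-assoc; xor-comm; xor-identityˡ; xor-identityʳ; xor-same; not-involutive;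
         not-distribˡ-xor; not-distribʳ-xor; xor-annihilates-not; ∧-zeroʳ; ∧-identityʳ)
open import Data.Nat using (ℕ; zero; suc; _+_; _*_; _^_; _≤_; _<_; z≤n; s≤s)
open import Data.Nat.Properties
  using (*-suc; ^-monoʳ-<; _≤?_; ≰⇒>; suc-injective; +-*-semiring; m+n≡0⇒m≡0; m+n≡0⇒n≡0;
         +-cancelˡ-≡; +-cancelʳ-≡; *-cancelˡ-≡; <-irrefl; m≤m+n)
open import Algebra.Properties.Semiring.Sum +-*-semiring
  using (sum-syntax; ∑-distrib-+; ∑-comm; sum-cong-≗; *-distribˡ-sum)
open import Data.Fin using (Fin; zero; suc; _≟_; combine; funToFin; finToFun)
open import Data.Fin.Patterns using (0F; 1F; 2F; 3F; 4F; 5F; 6F)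
open import Data.Fin.Properties using (pigeonhole; finToFun-funToFin; funToFin-finToFin; <⇒≢)
open import Data.Fin.Subset using (Subset; ⁅_⁆; ⊤; _∈_; _∉_; _⊆_; _∩_; _∪_; _─_; _-_; ∣_∣)
open import Data.Fin.Subset.Properties
  using (x∈⁅y⁆⇒x≡y; x∈p∧x≢y⇒x∈p-y; p─q⊆p; p─⊥≡p; ∉⊥; drop-∷-⊆; _∈?_; ∈⊤; ∣⊤∣≡n;
         x∈p∩q⁺; x∈p∩q⁻; x∈p∪q⁺; ⊆-antisym; ∣p∣≤n)
open import Data.Vec using (Vec; []; _∷_; here; there; lookup; tabulate)
open import Data.Vec.Properties
  using (zipWith-assoc; zipWith-comm; zipWith-identityˡ; zipWith-identityʳ; lookup-zipWith;
         lookup-replicate; tabulate∘lookup; lookup∘tabulate; tabulate-cong; ∷-injective;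
         []=⇒lookup; lookup⇒[]=)
open import Data.Product using (Σ; ∃; ∃₂; _×_; _,_; proj₁; proj₂)
open import Data.Sum using (_⊎_; inj₁; inj₂)
open import Data.Empty using (⊥; ⊥-elim)
open import Relation.Nullary using (yes; no)
open import Relation.Binary.PropositionalEquality
open import Function using (_∘_)
open import Function.Definitions using (Injective)
open import Function.Bundles using (Equivalence; mk⇔)

private variable
  k m n : ℕ

⊕-assoc : (x y z : Vec Bool k) → (x ⊕ y) ⊕ z ≡ x ⊕ (y ⊕ z)
⊕-assoc = zipWith-assoc xor-assoc

⊕-comm : (x y : Vec Bool k) → x ⊕ y ≡ y ⊕ x
⊕-comm = zipWith-comm xor-comm

⊕-identityˡ : (x : Vec Bool k) → 𝟎 ⊕ x ≡ x
⊕-identityˡ = zipWith-identityˡ xor-identityˡ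

⊕-identityʳ : (x : Vec Bool k) → x ⊕ 𝟎 ≡ x
⊕-identityʳ = zipWith-identityʳ xor-identityʳ

⊕-self : (x : Vec Bool k) → x ⊕ x ≡ 𝟎
⊕-self []      = refl
⊕-self (a ∷ x) = cong₂ _∷_ (xor-same a) (⊕-self x)

⊕-cancelˡ : (x y : Vec Bool k) → x ⊕ (x ⊕ y) ≡ y
⊕-cancelˡ x y = begin
  x ⊕ (x ⊕ y) ≡⟨ ⊕-assoc x x y ⟨
  (x ⊕ x) ⊕ y ≡⟨ cong (_⊕ y) (⊕-self x) ⟩
  𝟎 ⊕ y       ≡⟨ ⊕-identityˡ y ⟩
  y           ∎
  where open ≡-Reasoning

⊕≡𝟎⇒≡ : (x y : Vec Bool k) → x ⊕ y ≡ 𝟎 → x ≡ y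
⊕≡𝟎⇒≡ x y x⊕y≡𝟎 = begin
  x           ≡⟨ ⊕-identityʳ x ⟨
  x ⊕ 𝟎       ≡⟨ cong (x ⊕_) (⊕-self y) ⟨
  x ⊕ (y ⊕ y) ≡⟨ ⊕-assoc x y y ⟨
  (x ⊕ y) ⊕ y ≡⟨ cong (_⊕ y) x⊕y≡𝟎 ⟩
  𝟎 ⊕ y       ≡⟨ ⊕-identityˡ y ⟩
  y           ∎
  where open ≡-Reasoning

⊕-interchange : (a b c d : Vec Bool k) → (a ⊕ b) ⊕ (c ⊕ d) ≡ (a ⊕ c) ⊕ (b ⊕ d)
⊕-interchange a b c d = begin
  (a ⊕ b) ⊕ (c ⊕ d) ≡⟨ ⊕-assoc a b (c ⊕ d) ⟩
  a ⊕ (b ⊕ (c ⊕ d)) ≡⟨ cong (a ⊕_) (⊕-assoc b c d) ⟨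
  a ⊕ ((b ⊕ c) ⊕ d) ≡⟨ cong (λ z → a ⊕ (z ⊕ d)) (⊕-comm b c) ⟩
  a ⊕ ((c ⊕ b) ⊕ d) ≡⟨ cong (a ⊕_) (⊕-assoc c b d) ⟩
  a ⊕ (c ⊕ (b ⊕ d)) ≡⟨ ⊕-assoc a c (b ⊕ d) ⟨
  (a ⊕ c) ⊕ (b ⊕ d) ∎
  where open ≡-Reasoning

lookup-⊕ : (x y : Vec Bool k) (i : Fin k) → lookup (x ⊕ y) i ≡ lookup x i xor lookup y i
lookup-⊕ x y i = lookup-zipWith _xor_ i x y

lookup-𝟎 : (i : Fin k) → lookup (𝟎 {k}) i ≡ false
lookup-𝟎 i = lookup-replicate i false

≗⇒≡ : (x y : Vec Bool k) → (∀ i → lookup x i ≡ lookup y i) → x ≡ y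
≗⇒≡ x y x≗y = trans (sym (tabulate∘lookup x)) (trans (tabulate-cong x≗y) (tabulate∘lookup y))

∈⇒lookup : {x : Fin k} {p : Subset k} → x ∈ p → lookup p x ≡ true
∈⇒lookup = []=⇒lookup

lookup⇒∈ : {x : Fin k} {p : Subset k} → lookup p x ≡ true → x ∈ p
lookup⇒∈ = lookup⇒[]= _ _

∉⇒lookup : {x : Fin k} {p : Subset k} → x ∉ p → lookup p x ≡ false
∉⇒lookup {x = x} {p} x∉p with lookup p x in eq
... | true  = ⊥-elim (x∉p (lookup⇒∈ eq))
... | false = refl

lookup⇒∉ : {x : Fin k} {p : Subset k} → lookup p x ≡ false → x ∉ p
lookup⇒∉ eq x∈p with () ← trans (sym (∈⇒lookup x∈p)) eq

lookup-∩ : (p q : Subset k) (y : Fin k) → lookup (p ∩ q) y ≡ lookup p y ∧ lookup q y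
lookup-∩ p q y = lookup-zipWith _∧_ y p q

lookup-∪ : (p q : Subset k) (y : Fin k) → lookup (p ∪ q) y ≡ lookup p y ∨ lookup q y
lookup-∪ p q y = lookup-zipWith _∨_ y p q

lookup-─ : (p q : Subset k) (y : Fin k) → lookup (p ─ q) y ≡ lookup p y ∧ not (lookup q y)
lookup-─ (a ∷ p) (true  ∷ q) zero    = sym (∧-zeroʳ a)
lookup-─ (a ∷ p) (false ∷ q) zero    = sym (∧-identityʳ a)
lookup-─ (a ∷ p) (b     ∷ q) (suc y) = lookup-─ p q y

∈⇒≢ : {x y : Fin k} {p : Subset k} → x ∉ p → y ∈ p → y ≢ x
∈⇒≢ x∉p y∈p refl = x∉p y∈p

∈-⊕⁻ : {y : Fin k} (p q : Subset k) → y ∈ p ⊕ q → y ∈ p ⊎ y ∈ q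
∈-⊕⁻ {y = y} p q y∈p⊕q with lookup p y in eq
... | true  = inj₁ (lookup⇒∈ eq)
... | false = inj₂ (lookup⇒∈ (trans (sym (cong (_xor lookup q y) eq))
                                     (trans (sym (lookup-⊕ p q y)) (∈⇒lookup y∈p⊕q))))

⊕-⊆ : {X Y R : Subset k} → X ⊆ R → Y ⊆ R → X ⊕ Y ⊆ R
⊕-⊆ {X = X} {Y} X⊆R Y⊆R y∈X⊕Y with ∈-⊕⁻ X Y y∈X⊕Y
... | inj₁ y∈X = X⊆R y∈X
... | inj₂ y∈Y = Y⊆R y∈Y

≢⇒∃∈⊕ : {x y : Subset k} → x ≢ y → ∃ λ i → i ∈ x ⊕ y
≢⇒∃∈⊕ {x = []}        {[]}        x≢y = ⊥-elim (x≢y refl)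
≢⇒∃∈⊕ {x = true ∷ x}  {false ∷ y} _   = zero , here
≢⇒∃∈⊕ {x = false ∷ x} {true ∷ y}  _   = zero , here
≢⇒∃∈⊕ {x = true ∷ x}  {true ∷ y}  x≢y =
  let i , i∈x⊕y = ≢⇒∃∈⊕ (x≢y ∘ cong (true ∷_)) in suc i , there i∈x⊕y
≢⇒∃∈⊕ {x = false ∷ x} {false ∷ y} x≢y =
  let i , i∈x⊕y = ≢⇒∃∈⊕ (x≢y ∘ cong (false ∷_)) in suc i , there i∈x⊕y

∈-─⁻ : {y : Fin k} (p q : Subset k) → y ∈ p ─ q → y ∈ p × y ∉ q
∈-─⁻ {y = y} p q y∈p─q = p─q⊆p p q y∈p─q , λ y∈q → lookup⇒∉ (y∉p─q y∈q) y∈p─q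
  where
  y∉p─q : y ∈ q → lookup (p ─ q) y ≡ false
  y∉p─q y∈q = trans (lookup-─ p q y) (trans (cong (λ b → lookup p y ∧ not b) (∈⇒lookup y∈q)) (∧-zeroʳ _))

x∉p-x : (p : Subset k) (x : Fin k) → x ∉ p - x
x∉p-x (b ∷ p) zero    ()
x∉p-x (b ∷ p) (suc x) (there x∈p-x) = x∉p-x p x x∈p-x

∈-remove⁻ : {y x : Fin k} {p : Subset k} → y ∈ p - x → y ∈ p × y ≢ x
∈-remove⁻ {p = p} y∈p-x = p─q⊆p p _ y∈p-x , λ { refl → x∉p-x p _ y∈p-x }

∩-remove : {p q : Subset k} {x y : Fin k} → x ∉ q → y ∉ p → (p - x) ∩ (q - y) ≡ p ∩ q
∩-remove {p = p} {q} x∉q y∉p = ⊆-antisym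
  (λ z∈ → let z∈p-x , z∈q-y = x∈p∩q⁻ (p - _) (q - _) z∈
          in x∈p∩q⁺ (proj₁ (∈-remove⁻ z∈p-x) , proj₁ (∈-remove⁻ z∈q-y)))
  (λ z∈ → let z∈p , z∈q = x∈p∩q⁻ p q z∈
          in x∈p∩q⁺ (x∈p∧x≢y⇒x∈p-y z∈p (∈⇒≢ x∉q z∈q) , x∈p∧x≢y⇒x∈p-y z∈q (∈⇒≢ y∉p z∈p)))

-≡⊕⁅⁆ : {x : Fin k} {p : Subset k} → x ∈ p → p - x ≡ p ⊕ ⁅ x ⁆
-≡⊕⁅⁆ {p = _ ∷ p} here        = cong (false ∷_) (trans (p─⊥≡p p) (sym (⊕-identityʳ p)))
-≡⊕⁅⁆ {p = b ∷ p} (there x∈p) = cong₂ _∷_ (sym (xor-identityʳ b)) (-≡⊕⁅⁆ x∈p)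

∣p∣≡1+∣p-x∣ : {x : Fin k} {p : Subset k} → x ∈ p → ∣ p ∣ ≡ suc ∣ p - x ∣
∣p∣≡1+∣p-x∣ {p = _ ∷ p} here        = cong (suc ∘ ∣_∣) (sym (p─⊥≡p p))
∣p∣≡1+∣p-x∣ {p = true ∷ p} (there x∈p) = cong suc (∣p∣≡1+∣p-x∣ x∈p)
∣p∣≡1+∣p-x∣ {p = false ∷ p} (there x∈p) = ∣p∣≡1+∣p-x∣ x∈p

∣p-x∣≡ : {x : Fin k} {p : Subset k} → x ∈ p → ∣ p ∣ ≡ suc m → ∣ p - x ∣ ≡ m
∣p-x∣≡ x∈p ∣p∣≡1+m = suc-injective (trans (sym (∣p∣≡1+∣p-x∣ x∈p)) ∣p∣≡1+m)

∣p∣≡0⇒≡𝟎 : (T : Subset k) → ∣ T ∣ ≡ 0 → T ≡ 𝟎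
∣p∣≡0⇒≡𝟎 []          _      = refl
∣p∣≡0⇒≡𝟎 (false ∷ T) ∣T∣≡0 = cong (false ∷_) (∣p∣≡0⇒≡𝟎 T ∣T∣≡0)

∣p∣≡suc⇒∃∈ : (T : Subset k) → ∣ T ∣ ≡ suc m → ∃ λ x → x ∈ T × ∣ T - x ∣ ≡ m
∣p∣≡suc⇒∃∈ (true ∷ T)  ∣T∣≡1+m = zero , here , trans (cong ∣_∣ (p─⊥≡p T)) (suc-injective ∣T∣≡1+m)
∣p∣≡suc⇒∃∈ (false ∷ T) ∣T∣≡1+m =
  let x , x∈T , ∣T-x∣≡m = ∣p∣≡suc⇒∃∈ T ∣T∣≡1+m in suc x , there x∈T , ∣T-x∣≡m

sumOver-cong : (F G : Fin k → Point n) (T : Subset k) →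
  (∀ i → i ∈ T → F i ≡ G i) → sumOver F T ≡ sumOver G T
sumOver-cong F G []          F≗G = refl
sumOver-cong F G (true ∷ T)  F≗G =
  cong₂ _⊕_ (F≗G zero here) (sumOver-cong (F ∘ suc) (G ∘ suc) T (λ i → F≗G (suc i) ∘ there))
sumOver-cong F G (false ∷ T) F≗G = sumOver-cong (F ∘ suc) (G ∘ suc) T (λ i → F≗G (suc i) ∘ there)

sumOver-𝟎 : (F : Fin k → Point n) → sumOver F 𝟎 ≡ 𝟎
sumOver-𝟎 {zero}  F = refl
sumOver-𝟎 {suc k} F = sumOver-𝟎 (F ∘ suc)

sumOver-zeros : (F : Fin k → Point n) (T : Subset k) → (∀ i → i ∈ T → F i ≡ 𝟎) → sumOver F T ≡ 𝟎
sumOver-zeros F []          F≡𝟎 = refl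
sumOver-zeros F (true ∷ T)  F≡𝟎 =
  trans (cong₂ _⊕_ (F≡𝟎 zero here) (sumOver-zeros (F ∘ suc) T (λ i → F≡𝟎 (suc i) ∘ there))) (⊕-self 𝟎)
sumOver-zeros F (false ∷ T) F≡𝟎 = sumOver-zeros (F ∘ suc) T (λ i → F≡𝟎 (suc i) ∘ there)

sumOver-⊕ : (F : Fin k → Point n) (T U : Subset k) → sumOver F (T ⊕ U) ≡ sumOver F T ⊕ sumOver F U
sumOver-⊕ F []          []          = sym (⊕-self 𝟎)
sumOver-⊕ F (true ∷ T)  (true ∷ U)  = begin
  σ (T ⊕ U)                      ≡⟨ sumOver-⊕ (F ∘ suc) T U ⟩
  σ T ⊕ σ U                      ≡⟨ ⊕-identityˡ _ ⟨
  𝟎 ⊕ (σ T ⊕ σ U)                ≡⟨ cong (_⊕ (σ T ⊕ σ U)) (⊕-self (F zero)) ⟨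
  (F zero ⊕ F zero) ⊕ (σ T ⊕ σ U) ≡⟨ ⊕-interchange (F zero) (σ T) (F zero) (σ U) ⟨
  (F zero ⊕ σ T) ⊕ (F zero ⊕ σ U) ∎
  where open ≡-Reasoning
        σ = sumOver (F ∘ suc)
sumOver-⊕ F (true ∷ T)  (false ∷ U) =
  trans (cong (F zero ⊕_) (sumOver-⊕ (F ∘ suc) T U)) (sym (⊕-assoc _ _ _))
sumOver-⊕ F (false ∷ T) (true ∷ U)  = begin
  F zero ⊕ σ (T ⊕ U)   ≡⟨ cong (F zero ⊕_) (sumOver-⊕ (F ∘ suc) T U) ⟩
  F zero ⊕ (σ T ⊕ σ U) ≡⟨ ⊕-assoc (F zero) (σ T) (σ U) ⟨
  (F zero ⊕ σ T) ⊕ σ U ≡⟨ cong (_⊕ σ U) (⊕-comm (F zero) (σ T)) ⟩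
  (σ T ⊕ F zero) ⊕ σ U ≡⟨ ⊕-assoc (σ T) (F zero) (σ U) ⟩
  σ T ⊕ (F zero ⊕ σ U) ∎
  where open ≡-Reasoning
        σ = sumOver (F ∘ suc)
sumOver-⊕ F (false ∷ T) (false ∷ U) = sumOver-⊕ (F ∘ suc) T U

sumOver-⁅⁆ : (F : Fin k → Point n) (i : Fin k) → sumOver F ⁅ i ⁆ ≡ F i
sumOver-⁅⁆ F zero    = trans (cong (F zero ⊕_) (sumOver-𝟎 (F ∘ suc))) (⊕-identityʳ (F zero))
sumOver-⁅⁆ F (suc i) = sumOver-⁅⁆ (F ∘ suc) i

sumOver-remove : (F : Fin k → Point n) {T : Subset k} {x : Fin k} → x ∈ T →
  sumOver F T ≡ F x ⊕ sumOver F (T - x)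
sumOver-remove F {T} {x} x∈T = begin
  sumOver F T                              ≡⟨ ⊕-cancelˡ (F x) _ ⟨
  F x ⊕ (F x ⊕ sumOver F T)                ≡⟨ cong (λ z → F x ⊕ (z ⊕ sumOver F T)) (sumOver-⁅⁆ F x) ⟨
  F x ⊕ (sumOver F ⁅ x ⁆ ⊕ sumOver F T)    ≡⟨ cong (F x ⊕_) (⊕-comm _ _) ⟩
  F x ⊕ (sumOver F T ⊕ sumOver F ⁅ x ⁆)    ≡⟨ cong (F x ⊕_) (sumOver-⊕ F T ⁅ x ⁆) ⟨
  F x ⊕ sumOver F (T ⊕ ⁅ x ⁆)              ≡⟨ cong (λ U → F x ⊕ sumOver F U) (-≡⊕⁅⁆ x∈T) ⟨
  F x ⊕ sumOver F (T - x)                  ∎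
  where open ≡-Reasoning

sumOver-∣∣≡0 : (F : Fin k → Point n) (T : Subset k) → ∣ T ∣ ≡ 0 → sumOver F T ≡ 𝟎
sumOver-∣∣≡0 F T ∣T∣≡0 = trans (cong (sumOver F) (∣p∣≡0⇒≡𝟎 T ∣T∣≡0)) (sumOver-𝟎 F)

sumOver-sumOver : (G : Fin m → Point n) (c : Fin k → Subset m) (T : Subset k) →
  sumOver (λ i → sumOver G (c i)) T ≡ sumOver G (sumOver c T)
sumOver-sumOver {k = zero}  G c []          = sym (sumOver-𝟎 G)
sumOver-sumOver {k = suc k} G c (true ∷ T)  =
  trans (cong (sumOver G (c zero) ⊕_) (sumOver-sumOver G (c ∘ suc) T)) (sym (sumOver-⊕ G (c zero) _))
sumOver-sumOver {k = suc k} G c (false ∷ T) = sumOver-sumOver G (c ∘ suc) T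

sumOver-⊆ : (G : Fin k → Subset m) (T : Subset k) (Q : Subset m) →
  (∀ i → i ∈ T → G i ⊆ Q) → sumOver G T ⊆ Q
sumOver-⊆ G []          Q G⊆Q y∈𝟎 = ⊥-elim (∉⊥ y∈𝟎)
sumOver-⊆ G (true ∷ T)  Q G⊆Q y∈ with ∈-⊕⁻ (G zero) _ y∈
... | inj₁ y∈G₀ = G⊆Q zero here y∈G₀
... | inj₂ y∈σ = sumOver-⊆ (G ∘ suc) T Q (λ i → G⊆Q (suc i) ∘ there) y∈σ
sumOver-⊆ G (false ∷ T) Q G⊆Q = sumOver-⊆ (G ∘ suc) T Q (λ i → G⊆Q (suc i) ∘ there)

par : Vec Bool k → Bool
par []      = false
par (b ∷ v) = b xor par v

parity : ℕ → Bool
parity zero    = false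
parity (suc m) = not (parity m)

xor-interchange : ∀ a b c d → (a xor b) xor (c xor d) ≡ (a xor c) xor (b xor d)
xor-interchange false false c d = refl
xor-interchange false true  c d = not-distribʳ-xor c d
xor-interchange true  false c d = not-distribˡ-xor c d
xor-interchange true  true  c d = sym (xor-annihilates-not c d)

par-⊕ : (x y : Vec Bool k) → par (x ⊕ y) ≡ par x xor par y
par-⊕ []      []      = refl
par-⊕ (a ∷ x) (b ∷ y) =
  trans (cong ((a xor b) xor_) (par-⊕ x y)) (xor-interchange a b (par x) (par y))

par-𝟎 : par (𝟎 {k}) ≡ false
par-𝟎 {zero}  = refl
par-𝟎 {suc k} = par-𝟎 {k}

par-⁅⁆ : (i : Fin k) → par ⁅ i ⁆ ≡ true
par-⁅⁆ {suc k} zero    = cong not (par-𝟎 {k})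
par-⁅⁆         (suc i) = par-⁅⁆ i

par≡parity∣∣ : (T : Subset k) → par T ≡ parity ∣ T ∣
par≡parity∣∣ []          = refl
par≡parity∣∣ (true ∷ T)  = cong not (par≡parity∣∣ T)
par≡parity∣∣ (false ∷ T) = par≡parity∣∣ T

parity-2* : ∀ j → parity (2 * j) ≡ false
parity-2* zero    = refl
parity-2* (suc j) = trans (cong parity (*-suc 2 j)) (trans (not-involutive _) (parity-2* j))

Odd⇒parity : Odd m → parity m ≡ true
Odd⇒parity (j , refl) = cong not (parity-2* j)

parity⇒Odd : parity m ≡ true → Odd m
parity⇒Odd {suc zero}    _   = 0 , refl
parity⇒Odd {suc (suc m)} odd with parity⇒Odd {m} (trans (sym (not-involutive _)) odd)
... | j , refl = suc j , cong suc (sym (*-suc 2 j))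

parity⇒Even : parity m ≡ false → ∃ λ j → m ≡ 2 * j
parity⇒Even {zero}        _    = 0 , refl
parity⇒Even {suc (suc m)} even with parity⇒Even {m} (trans (sym (not-involutive _)) even)
... | j , refl = suc j , sym (*-suc 2 j)

par-sumOver : (G : Fin k → Vec Bool m) (T : Subset k) (b : Bool) →
  (∀ i → i ∈ T → par (G i) ≡ b) → par (sumOver G T) ≡ b ∧ par T
par-sumOver {zero} {m} G [] b _ = trans (par-𝟎 {m}) (sym (∧-zeroʳ b))
par-sumOver {suc k} G (true ∷ T)  b parG = begin
  par (G zero ⊕ sumOver (G ∘ suc) T)         ≡⟨ par-⊕ (G zero) _ ⟩
  par (G zero) xor par (sumOver (G ∘ suc) T) ≡⟨ cong₂ _xor_ (parG zero here)
                                                   (par-sumOver (G ∘ suc) T b (λ i → parG (suc i) ∘ there)) ⟩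
  b xor (b ∧ par T)                          ≡⟨ xor-∧-self b (par T) ⟩
  b ∧ not (par T)                            ∎
  where
  open ≡-Reasoning
  xor-∧-self : ∀ b c → b xor (b ∧ c) ≡ b ∧ not c
  xor-∧-self true  c = refl
  xor-∧-self false c = refl
par-sumOver {suc k} G (false ∷ T) b parG = par-sumOver (G ∘ suc) T b (λ i → parG (suc i) ∘ there)

lookup-sumOver : (t : Fin m → Subset k) (β : Subset m) (y : Fin k) →
  lookup (sumOver t β) y ≡ par (β ∩ tabulate (λ i → lookup (t i) y))
lookup-sumOver t []          y = lookup-𝟎 y
lookup-sumOver t (true ∷ β)  y =
  trans (lookup-⊕ (t zero) _ y) (cong (lookup (t zero) y xor_) (lookup-sumOver (t ∘ suc) β y))
lookup-sumOver t (false ∷ β) y = lookup-sumOver (t ∘ suc) β y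

-- Linear dependence

private
  toFin2 : Bool → Fin 2
  toFin2 false = zero
  toFin2 true  = suc zero

  fromFin2 : Fin 2 → Bool
  fromFin2 zero       = false
  fromFin2 (suc zero) = true

  toFin2-injective : ∀ {a b} → toFin2 a ≡ toFin2 b → a ≡ b
  toFin2-injective {false} {false} _ = refl
  toFin2-injective {true}  {true}  _ = refl

  toFin2∘fromFin2 : ∀ i → toFin2 (fromFin2 i) ≡ i
  toFin2∘fromFin2 zero       = refl
  toFin2∘fromFin2 (suc zero) = refl

  funToFin-cong : {f g : Fin k → Fin n} → (∀ i → f i ≡ g i) → funToFin f ≡ funToFin g
  funToFin-cong {zero}  _   = refl
  funToFin-cong {suc k} f≗g = cong₂ combine (f≗g zero) (funToFin-cong (f≗g ∘ suc))

  encode : Subset k → Fin (2 ^ k)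
  encode A = funToFin (toFin2 ∘ lookup A)

  decode : Fin (2 ^ k) → Subset k
  decode i = tabulate (fromFin2 ∘ finToFun i)

  encode-injective : (A B : Subset k) → encode A ≡ encode B → A ≡ B
  encode-injective A B eq = ≗⇒≡ A B λ y → toFin2-injective (begin
    toFin2 (lookup A y)              ≡⟨ finToFun-funToFin (toFin2 ∘ lookup A) y ⟨
    finToFun (encode A) y            ≡⟨ cong (λ i → finToFun i y) eq ⟩
    finToFun (encode B) y            ≡⟨ finToFun-funToFin (toFin2 ∘ lookup B) y ⟩
    toFin2 (lookup B y)              ∎)
    where open ≡-Reasoning

  encode∘decode : (i : Fin (2 ^ k)) → encode {k} (decode i) ≡ i
  encode∘decode {k} i =
    trans (funToFin-cong {k} λ y → trans (cong toFin2 (lookup∘tabulate (fromFin2 ∘ finToFun i) y))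
                                         (toFin2∘fromFin2 (finToFun i y)))
          (funToFin-finToFin {k} i)

-- Opaque, so that type checking the uses below never unfolds the exhaustive pigeonhole search.
opaque
  subset-pigeonhole : m < k → (f : Subset k → Subset m) → ∃₂ λ A A′ → A ≢ A′ × f A ≡ f A′
  subset-pigeonhole {m} {k} m<k f
    with i , j , i<j , eq ← pigeonhole (^-monoʳ-< 2 (s≤s (s≤s z≤n)) m<k) (encode ∘ f ∘ decode)
    = decode i , decode j
    , (λ dᵢ≡dⱼ → <⇒≢ i<j (trans (sym (encode∘decode {k} i)) (trans (cong encode dᵢ≡dⱼ) (encode∘decode {k} j))))
    , encode-injective _ _ eq

expand : (R : Subset k) → Subset ∣ R ∣ → Subset k
expand []          []      = []
expand (true ∷ R)  (b ∷ A) = b ∷ expand R A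
expand (false ∷ R) A       = false ∷ expand R A

expand-⊆ : (R : Subset k) (A : Subset ∣ R ∣) → expand R A ⊆ R
expand-⊆ (true ∷ R)  (b ∷ A) here          = here
expand-⊆ (true ∷ R)  (b ∷ A) (there y∈)    = there (expand-⊆ R A y∈)
expand-⊆ (false ∷ R) A       (there y∈)    = there (expand-⊆ R A y∈)

expand-injective : (R : Subset k) (A A′ : Subset ∣ R ∣) → expand R A ≡ expand R A′ → A ≡ A′
expand-injective []          []      []        _  = refl
expand-injective (true ∷ R)  (b ∷ A) (b′ ∷ A′) eq with refl , eq′ ← ∷-injective eq =
  cong (b ∷_) (expand-injective R A A′ eq′)
expand-injective (false ∷ R) A       A′        eq = expand-injective R A A′ (proj₂ (∷-injective eq))

restrict : (Q : Subset m) → Subset m → Subset ∣ Q ∣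
restrict []          []      = []
restrict (true ∷ Q)  (b ∷ X) = b ∷ restrict Q X
restrict (false ∷ Q) (_ ∷ X) = restrict Q X

restrict-injective : (Q X Y : Subset m) → X ⊆ Q → Y ⊆ Q → restrict Q X ≡ restrict Q Y → X ≡ Y
restrict-injective []          []          []          _   _   _  = refl
restrict-injective (true ∷ Q)  (a ∷ X)     (b ∷ Y)     X⊆Q Y⊆Q eq with refl , eq′ ← ∷-injective eq =
  cong (a ∷_) (restrict-injective Q X Y (drop-∷-⊆ X⊆Q) (drop-∷-⊆ Y⊆Q) eq′)
restrict-injective (false ∷ Q) (true ∷ X)  _           X⊆Q _   _  with () ← X⊆Q here
restrict-injective (false ∷ Q) (false ∷ X) (true ∷ Y)  _   Y⊆Q _  with () ← Y⊆Q here
restrict-injective (false ∷ Q) (false ∷ X) (false ∷ Y) X⊆Q Y⊆Q eq =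
  cong (false ∷_) (restrict-injective Q X Y (drop-∷-⊆ X⊆Q) (drop-∷-⊆ Y⊆Q) eq)

-- There are 2 ^ ∣ R ∣ subsets of R but only 2 ^ ∣ Q ∣ possible sums.
dependent-subfamily : (c : Fin k → Subset m) (Q : Subset m) (R : Subset k) →
  (∀ i → c i ⊆ Q) → ∣ Q ∣ < ∣ R ∣ → ∃₂ λ A a → A ⊆ R × a ∈ A × sumOver c A ≡ 𝟎
dependent-subfamily c Q R c⊆Q ∣Q∣<∣R∣
  with A , A′ , A≢A′ , eq ← subset-pigeonhole ∣Q∣<∣R∣ (restrict Q ∘ sumOver c ∘ expand R)
  with a , a∈ ← ≢⇒∃∈⊕ (A≢A′ ∘ expand-injective R A A′)
  = expand R A ⊕ expand R A′ , a , ⊕-⊆ (expand-⊆ R A) (expand-⊆ R A′) , a∈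
  , trans (sumOver-⊕ c _ _) (≡⇒⊕≡𝟎 (restrict-injective Q _ _ (sum⊆Q _) (sum⊆Q _) eq))
  where
  sum⊆Q : ∀ E → sumOver c E ⊆ Q
  sum⊆Q E = sumOver-⊆ c E Q (λ i _ → c⊆Q i)
  ≡⇒⊕≡𝟎 : {x y : Subset m} → x ≡ y → x ⊕ y ≡ 𝟎
  ≡⇒⊕≡𝟎 refl = ⊕-self _

-- Affine combinations and affine relations

odd⇒par : (T : Subset k) → Odd ∣ T ∣ → par T ≡ true
odd⇒par T odd = trans (par≡parity∣∣ T) (Odd⇒parity odd)

par⇒odd : (T : Subset k) → par T ≡ true → Odd ∣ T ∣
par⇒odd T p = parity⇒Odd (trans (sym (par≡parity∣∣ T)) p)

AffineRelation : (Fin k → Point n) → Subset k → Set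
AffineRelation S T = sumOver S T ≡ 𝟎 × par T ≡ false

InAff-mono : {S : Fin k → Point n} {U V : Subset k} {x : Point n} → U ⊆ V → InAff S U x → InAff S V x
InAff-mono U⊆V (T , T⊆U , odd , sum) = T , U⊆V ∘ T⊆U , odd , sum

InAff-∈ : {S : Fin k → Point n} {U : Subset k} {i : Fin k} → i ∈ U → InAff S U (S i)
InAff-∈ {S = S} {i = i} i∈U =
  ⁅ i ⁆ , (λ y∈⁅i⁆ → subst (_∈ _) (sym (x∈⁅y⁆⇒x≡y i y∈⁅i⁆)) i∈U) , par⇒odd ⁅ i ⁆ (par-⁅⁆ i) , sumOver-⁅⁆ S i

InAff-trans : {S : Fin k → Point n} {P : Fin m → Point n} {U : Subset k} {Q : Subset m} {x : Point n} →
  (∀ j → j ∈ U → InAff P Q (S j)) → InAff S U x → InAff P Q x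
InAff-trans {k} {m = m} {S = S} {P} {U} {Q} {x} S⊆affP (T , T⊆U , odd , sumT≡x) =
  sumOver c T , sumOver-⊆ c T Q (λ j j∈T → proj₁ (c-spec j (T⊆U j∈T)))
  , par⇒odd (sumOver c T) (trans (par-sumOver c T true (λ j j∈T → proj₁ (proj₂ (c-spec j (T⊆U j∈T))))) (odd⇒par T odd))
  , (begin
      sumOver P (sumOver c T)          ≡⟨ sumOver-sumOver P c T ⟨
      sumOver (sumOver P ∘ c) T        ≡⟨ sumOver-cong _ S T (λ j j∈T → proj₂ (proj₂ (c-spec j (T⊆U j∈T)))) ⟩
      sumOver S T                      ≡⟨ sumT≡x ⟩
      x                                ∎)
  where
  open ≡-Reasoning
  c : Fin k → Subset m
  c j with j ∈? U
  ... | yes j∈U = proj₁ (S⊆affP j j∈U)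
  ... | no  _   = 𝟎   -- never used: T ⊆ U
  c-spec : ∀ j → j ∈ U → c j ⊆ Q × par (c j) ≡ true × sumOver P (c j) ≡ S j
  c-spec j j∈U with j ∈? U
  ... | yes j∈U′ = let T , T⊆Q , odd , sum = S⊆affP j j∈U′ in T⊆Q , odd⇒par T odd , sum
  ... | no  j∉U  = ⊥-elim (j∉U j∈U)

relation-remove : {S : Fin k → Point n} {E : Subset k} {j : Fin k} →
  AffineRelation S E → j ∈ E → InAff S (E - j) (S j)
relation-remove {S = S} {E} {j} (sumE≡𝟎 , parE) j∈E =
  E - j , (λ y∈ → y∈)
  , par⇒odd (E - j) (trans (cong par (-≡⊕⁅⁆ j∈E)) (trans (par-⊕ E ⁅ j ⁆) (cong₂ _xor_ parE (par-⁅⁆ j))))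
  , sym (⊕≡𝟎⇒≡ (S j) _ (trans (sym (sumOver-remove S j∈E)) sumE≡𝟎))

relation-sumOver : {S : Fin k → Point n} (t : Fin m → Subset k) →
  (∀ i → AffineRelation S (t i)) → (β : Subset m) → AffineRelation S (sumOver t β)
relation-sumOver {S = S} t rel β =
  trans (sym (sumOver-sumOver S t β)) (sumOver-zeros (sumOver S ∘ t) β (λ i _ → proj₁ (rel i)))
  , par-sumOver t β false (λ i _ → proj₂ (rel i))

independent⇒no-relation : {P : Fin m → Point n} {E : Subset m} {j : Fin m} →
  AffIndep P ⊤ → AffineRelation P E → j ∈ E → ⊥
independent⇒no-relation P-indep rel j∈E =
  P-indep _ ∈⊤ (InAff-mono (λ y∈ → let y∈E , y≢j = ∈-remove⁻ y∈ in x∈p∧x≢y⇒x∈p-y ∈⊤ y≢j)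
                           (relation-remove rel j∈E))

nonempty-relation-within : (S : Fin k → Point n) (P : Fin m → Point n) (Q : Subset m) (R : Subset k) →
  (∀ i → InAff P Q (S i)) → ∣ Q ∣ < ∣ R ∣ → ∃₂ λ T a → AffineRelation S T × T ⊆ R × a ∈ T
nonempty-relation-within {m = m} S P Q R S⊆affP ∣Q∣<∣R∣ =
  let T , a , T⊆R , a∈T , ΣcT≡𝟎 = dependent-subfamily c Q R (λ i → proj₁ (proj₂ (S⊆affP i))) ∣Q∣<∣R∣
  in T , a , relation T ΣcT≡𝟎 , T⊆R , a∈T
  where
  c : Fin _ → Subset _
  c i = proj₁ (S⊆affP i)
  relation : ∀ T → sumOver c T ≡ 𝟎 → AffineRelation S T
  relation T ΣcT≡𝟎 =
    (begin
      sumOver S T               ≡⟨ sumOver-cong S _ T (λ i _ → sym (proj₂ (proj₂ (proj₂ (S⊆affP i))))) ⟩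
      sumOver (sumOver P ∘ c) T ≡⟨ sumOver-sumOver P c T ⟩
      sumOver P (sumOver c T)   ≡⟨ cong (sumOver P) ΣcT≡𝟎 ⟩
      sumOver P 𝟎               ≡⟨ sumOver-𝟎 P ⟩
      𝟎                         ∎)
    , (begin
      par T                     ≡⟨ par-sumOver c T true (λ i _ → odd⇒par (c i) (proj₁ (proj₂ (proj₂ (S⊆affP i))))) ⟨
      par (sumOver c T)         ≡⟨ cong par ΣcT≡𝟎 ⟩
      par (𝟎 {m})               ≡⟨ par-𝟎 {m} ⟩
      false                     ∎)
    where open ≡-Reasoning

independent-span-bound : (P : Fin m → Point n) (S : Fin k → Point n) (Q : Subset k) →
  AffIndep P ⊤ → (∀ j → InAff S Q (P j)) → m ≤ ∣ Q ∣
independent-span-bound {m} P S Q P-indep P⊆affS with m ≤? ∣ Q ∣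
... | yes m≤∣Q∣ = m≤∣Q∣
... | no  m≰∣Q∣ =
  let _ , _ , rel , _ , a∈T = nonempty-relation-within P S Q ⊤ P⊆affS
                                (subst (∣ Q ∣ <_) (sym (∣⊤∣≡n m)) (≰⇒> m≰∣Q∣))
  in ⊥-elim (independent⇒no-relation P-indep rel a∈T)

-- Affine relations in a cap

module _ {S : Fin k → Point n} (S-injective : Injective _≡_ _≡_ S) (cap : IsCap S) where

  relation-size≢2 : {T : Subset k} → AffineRelation S T → ∣ T ∣ ≢ 2
  relation-size≢2 {T} (ΣT≡𝟎 , _) ∣T∣≡2 =
    let x₁ , x₁∈T  , ∣T₁∣≡1 = ∣p∣≡suc⇒∃∈ T ∣T∣≡2
        x₂ , x₂∈T₁ , ∣T₂∣≡0 = ∣p∣≡suc⇒∃∈ (T - x₁) ∣T₁∣≡1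
        S₁⊕S₂≡𝟎 = begin
          S x₁ ⊕ S x₂                              ≡⟨ cong (S x₁ ⊕_) (⊕-identityʳ (S x₂)) ⟨
          S x₁ ⊕ (S x₂ ⊕ 𝟎)                        ≡⟨ cong (λ z → S x₁ ⊕ (S x₂ ⊕ z)) (sumOver-∣∣≡0 S (T - x₁ - x₂) ∣T₂∣≡0) ⟨
          S x₁ ⊕ (S x₂ ⊕ sumOver S (T - x₁ - x₂))   ≡⟨ cong (S x₁ ⊕_) (sumOver-remove S x₂∈T₁) ⟨
          S x₁ ⊕ sumOver S (T - x₁)                ≡⟨ sumOver-remove S x₁∈T ⟨
          sumOver S T                              ≡⟨ ΣT≡𝟎 ⟩
          𝟎                                        ∎
    in proj₂ (∈-remove⁻ x₂∈T₁) (sym (S-injective (⊕≡𝟎⇒≡ (S x₁) (S x₂) S₁⊕S₂≡𝟎)))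
    where open ≡-Reasoning

  relation-size≢4 : {T : Subset k} → AffineRelation S T → ∣ T ∣ ≢ 4
  relation-size≢4 {T} (ΣT≡𝟎 , _) ∣T∣≡4 =
    let x₁ , x₁∈T  , ∣T₁∣≡3 = ∣p∣≡suc⇒∃∈ T ∣T∣≡4
        x₂ , x₂∈T₁ , ∣T₂∣≡2 = ∣p∣≡suc⇒∃∈ (T - x₁) ∣T₁∣≡3
        x₃ , x₃∈T₂ , ∣T₃∣≡1 = ∣p∣≡suc⇒∃∈ (T - x₁ - x₂) ∣T₂∣≡2
        x₄ , x₄∈T₃ , ∣T₄∣≡0 = ∣p∣≡suc⇒∃∈ (T - x₁ - x₂ - x₃) ∣T₃∣≡1
        _ , x₂≢x₁ = ∈-remove⁻ x₂∈T₁
        x₃∈T₁ , x₃≢x₂ = ∈-remove⁻ x₃∈T₂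
        _ , x₃≢x₁ = ∈-remove⁻ x₃∈T₁
        x₄∈T₂ , x₄≢x₃ = ∈-remove⁻ x₄∈T₃
        x₄∈T₁ , x₄≢x₂ = ∈-remove⁻ x₄∈T₂
        _ , x₄≢x₁ = ∈-remove⁻ x₄∈T₁
        quad≡𝟎 = begin
          S x₁ ⊕ S x₂ ⊕ S x₃ ⊕ S x₄                  ≡⟨ ⊕-assoc (S x₁ ⊕ S x₂) (S x₃) (S x₄) ⟩
          (S x₁ ⊕ S x₂) ⊕ (S x₃ ⊕ S x₄)              ≡⟨ ⊕-assoc (S x₁) (S x₂) (S x₃ ⊕ S x₄) ⟩
          S x₁ ⊕ (S x₂ ⊕ (S x₃ ⊕ S x₄))              ≡⟨ cong (λ z → S x₁ ⊕ (S x₂ ⊕ (S x₃ ⊕ z))) (⊕-identityʳ (S x₄)) ⟨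
          S x₁ ⊕ (S x₂ ⊕ (S x₃ ⊕ (S x₄ ⊕ 𝟎)))        ≡⟨ cong (λ z → S x₁ ⊕ (S x₂ ⊕ (S x₃ ⊕ (S x₄ ⊕ z))))
                                                         (sumOver-∣∣≡0 S (T - x₁ - x₂ - x₃ - x₄) ∣T₄∣≡0) ⟨
          S x₁ ⊕ (S x₂ ⊕ (S x₃ ⊕ (S x₄ ⊕ sumOver S (T - x₁ - x₂ - x₃ - x₄))))
                                                    ≡⟨ cong (λ z → S x₁ ⊕ (S x₂ ⊕ (S x₃ ⊕ z))) (sumOver-remove S x₄∈T₃) ⟨
          S x₁ ⊕ (S x₂ ⊕ (S x₃ ⊕ sumOver S (T - x₁ - x₂ - x₃)))
                                                    ≡⟨ cong (λ z → S x₁ ⊕ (S x₂ ⊕ z)) (sumOver-remove S x₃∈T₂) ⟨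
          S x₁ ⊕ (S x₂ ⊕ sumOver S (T - x₁ - x₂))    ≡⟨ cong (S x₁ ⊕_) (sumOver-remove S x₂∈T₁) ⟨
          S x₁ ⊕ sumOver S (T - x₁)                  ≡⟨ sumOver-remove S x₁∈T ⟨
          sumOver S T                                ≡⟨ ΣT≡𝟎 ⟩
          𝟎                                          ∎
    in cap x₁ x₂ x₃ x₄ (≢-sym x₂≢x₁) (≢-sym x₃≢x₁) (≢-sym x₄≢x₁) (≢-sym x₃≢x₂) (≢-sym x₄≢x₂) (≢-sym x₄≢x₃) quad≡𝟎
    where open ≡-Reasoning

  relation-size≥6 : {T : Subset k} {a : Fin k} → AffineRelation S T → a ∈ T → 6 ≤ ∣ T ∣
  relation-size≥6 {T} rel@(_ , parT) a∈T =
    even-nonzero≥6 (trans (sym (par≡parity∣∣ T)) parT) (∣p∣≡1+∣p-x∣ a∈T) (relation-size≢2 rel) (relation-size≢4 rel)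
    where
    even-nonzero≥6 : ∀ {w m} → parity w ≡ false → w ≡ suc m → w ≢ 2 → w ≢ 4 → 6 ≤ w
    even-nonzero≥6 {1} () _ _ _
    even-nonzero≥6 {2} _  _ w≢2 _   = ⊥-elim (w≢2 refl)
    even-nonzero≥6 {3} () _ _ _
    even-nonzero≥6 {4} _  _ _   w≢4 = ⊥-elim (w≢4 refl)
    even-nonzero≥6 {5} () _ _ _
    even-nonzero≥6 {suc (suc (suc (suc (suc (suc w)))))} _ _ _ _ = s≤s (s≤s (s≤s (s≤s (s≤s (s≤s z≤n)))))

-- Counting elementwise

ind : Bool → ℕ
ind false = 0
ind true  = 1

∣p∣≡∑ : (p : Subset k) → ∣ p ∣ ≡ ∑[ y < k ] ind (lookup p y)
∣p∣≡∑ []          = refl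
∣p∣≡∑ (true ∷ p)  = cong suc (∣p∣≡∑ p)
∣p∣≡∑ (false ∷ p) = ∣p∣≡∑ p

infixl 6 _+ₑ_
infixl 7 _*ₑ_

data SizeExpr (k : ℕ) : Set where
  size : Subset k → SizeExpr k
  _+ₑ_ : SizeExpr k → SizeExpr k → SizeExpr k
  _*ₑ_ : ℕ → SizeExpr k → SizeExpr k

⟦_⟧ : SizeExpr k → ℕ
⟦ size V  ⟧ = ∣ V ∣
⟦ e +ₑ e′ ⟧ = ⟦ e ⟧ + ⟦ e′ ⟧
⟦ c *ₑ e  ⟧ = c * ⟦ e ⟧

infix 5 _at_

_at_ : SizeExpr k → Fin k → ℕ
size V  at y = ind (lookup V y)
e +ₑ e′ at y = (e at y) + (e′ at y)
c *ₑ e  at y = c * (e at y)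

⟦⟧≡∑at : (e : SizeExpr k) → ⟦ e ⟧ ≡ ∑[ y < k ] (e at y)
⟦⟧≡∑at (size V)  = ∣p∣≡∑ V
⟦⟧≡∑at (e +ₑ e′) = trans (cong₂ _+_ (⟦⟧≡∑at e) (⟦⟧≡∑at e′)) (sym (∑-distrib-+ (e at_) (e′ at_)))
⟦⟧≡∑at (c *ₑ e)  = trans (cong (c *_) (⟦⟧≡∑at e)) (*-distribˡ-sum c (e at_))

size-identity : (e e′ : SizeExpr k) → (∀ y → e at y ≡ e′ at y) → ⟦ e ⟧ ≡ ⟦ e′ ⟧
size-identity e e′ pointwise = trans (⟦⟧≡∑at e) (trans (sum-cong-≗ pointwise) (sym (⟦⟧≡∑at e′)))

2∣p∩q∣+∣p⊕q∣≡∣p∣+∣q∣ : (p q : Subset k) → 2 * ∣ p ∩ q ∣ + ∣ p ⊕ q ∣ ≡ ∣ p ∣ + ∣ q ∣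
2∣p∩q∣+∣p⊕q∣≡∣p∣+∣q∣ p q = size-identity (2 *ₑ size (p ∩ q) +ₑ size (p ⊕ q)) (size p +ₑ size q) elementwise
  where
  bits : ∀ a b → 2 * ind (a ∧ b) + ind (a xor b) ≡ ind a + ind b
  bits true  true  = refl
  bits true  false = refl
  bits false true  = refl
  bits false false = refl
  elementwise : ∀ y → 2 * ind (lookup (p ∩ q) y) + ind (lookup (p ⊕ q) y) ≡ ind (lookup p y) + ind (lookup q y)
  elementwise y rewrite lookup-∩ p q y | lookup-⊕ p q y = bits (lookup p y) (lookup q y)

4∣p─q∪r∣-inversion : (p q r : Subset k) →
  4 * ∣ p ─ (q ∪ r) ∣ + (∣ q ∣ + ∣ r ∣ + ∣ q ⊕ r ∣) ≡ ∣ p ∣ + ∣ p ⊕ q ∣ + ∣ p ⊕ r ∣ + ∣ p ⊕ q ⊕ r ∣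
4∣p─q∪r∣-inversion p q r =
  size-identity (4 *ₑ size (p ─ (q ∪ r)) +ₑ (size q +ₑ size r +ₑ size (q ⊕ r)))
                (size p +ₑ size (p ⊕ q) +ₑ size (p ⊕ r) +ₑ size (p ⊕ q ⊕ r)) elementwise
  where
  bits : ∀ a b c → 4 * ind (a ∧ not (b ∨ c)) + (ind b + ind c + ind (b xor c))
                   ≡ ind a + ind (a xor b) + ind (a xor c) + ind ((a xor b) xor c)
  bits true  true  true  = refl
  bits true  true  false = refl
  bits true  false true  = refl
  bits true  false false = refl
  bits false true  true  = refl
  bits false true  false = refl
  bits false false true  = refl
  bits false false false = refl
  elementwise : ∀ y →
    4 * ind (lookup (p ─ (q ∪ r)) y) + (ind (lookup q y) + ind (lookup r y) + ind (lookup (q ⊕ r) y))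
    ≡ ind (lookup p y) + ind (lookup (p ⊕ q) y) + ind (lookup (p ⊕ r) y) + ind (lookup (p ⊕ q ⊕ r) y)
  elementwise y rewrite lookup-─ p (q ∪ r) y | lookup-∪ q r y | lookup-⊕ q r y | lookup-⊕ (p ⊕ q) r y
                      | lookup-⊕ p q y | lookup-⊕ p r y = bits (lookup p y) (lookup q y) (lookup r y)

exclusive-element : (p q r : Subset k) →
  ∣ q ∣ + ∣ r ∣ + ∣ q ⊕ r ∣ < ∣ p ∣ + ∣ p ⊕ q ∣ + ∣ p ⊕ r ∣ + ∣ p ⊕ q ⊕ r ∣ → ∃ λ x → x ∈ p × x ∉ q × x ∉ r
exclusive-element p q r lt with ∣ p ─ (q ∪ r) ∣ in ∣X∣≡
... | zero  = ⊥-elim (<-irrefl (trans (cong (λ z → 4 * z + _) (sym ∣X∣≡)) (4∣p─q∪r∣-inversion p q r)) lt)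
... | suc _ =
  let x , x∈X , _ = ∣p∣≡suc⇒∃∈ (p ─ (q ∪ r)) ∣X∣≡
      x∈p , x∉q∪r = ∈-─⁻ p (q ∪ r) x∈X
  in x , x∈p , x∉q∪r ∘ x∈p∪q⁺ ∘ inj₁ , x∉q∪r ∘ x∈p∪q⁺ ∘ inj₂

intersection-size : (p q : Subset k) {a w : ℕ} → ∣ p ∣ ≡ 6 → ∣ q ∣ ≡ 6 → ∣ p ⊕ q ∣ ≡ w → 2 * a + w ≡ 12 →
  ∣ p ∩ q ∣ ≡ a
intersection-size p q {a} {w} ∣p∣≡6 ∣q∣≡6 ∣p⊕q∣≡w 2a+w≡12 =
  *-cancelˡ-≡ ∣ p ∩ q ∣ a 2 (+-cancelʳ-≡ w (2 * ∣ p ∩ q ∣) (2 * a) (begin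
    2 * ∣ p ∩ q ∣ + w          ≡⟨ cong (2 * ∣ p ∩ q ∣ +_) ∣p⊕q∣≡w ⟨
    2 * ∣ p ∩ q ∣ + ∣ p ⊕ q ∣  ≡⟨ 2∣p∩q∣+∣p⊕q∣≡∣p∣+∣q∣ p q ⟩
    ∣ p ∣ + ∣ q ∣              ≡⟨ cong₂ _+_ ∣p∣≡6 ∣q∣≡6 ⟩
    12                         ≡⟨ 2a+w≡12 ⟨
    2 * a + w                  ∎))
  where open ≡-Reasoning

nonzero : Fin 7 → Subset 3
nonzero 0F = true  ∷ false ∷ false ∷ []
nonzero 1F = false ∷ true  ∷ false ∷ []
nonzero 2F = false ∷ false ∷ true  ∷ []
nonzero 3F = true  ∷ true  ∷ false ∷ []
nonzero 4F = true  ∷ false ∷ true  ∷ []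
nonzero 5F = false ∷ true  ∷ true  ∷ []
nonzero 6F = true  ∷ true  ∷ true  ∷ []

∑-nonzero-combinations : (t : Fin 3 → Subset k) →
  ∑[ j < 7 ] ∣ sumOver t (nonzero j) ∣ ≡ 4 * ∣ t 0F ∪ t 1F ∪ t 2F ∣
∑-nonzero-combinations {k} t = begin
  ∑[ j < 7 ] ∣ comb j ∣                        ≡⟨ sum-cong-≗ (λ j → ∣p∣≡∑ (comb j)) ⟩
  ∑[ j < 7 ] ∑[ y < k ] ind (lookup (comb j) y) ≡⟨ ∑-comm (λ j y → ind (lookup (comb j) y)) ⟩
  ∑[ y < k ] ∑[ j < 7 ] ind (lookup (comb j) y) ≡⟨ sum-cong-≗ elementwise ⟩
  ∑[ y < k ] (4 * ind (lookup U y))             ≡⟨ *-distribˡ-sum 4 (λ y → ind (lookup U y)) ⟨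
  4 * ∑[ y < k ] ind (lookup U y)               ≡⟨ cong (4 *_) (∣p∣≡∑ U) ⟨
  4 * ∣ U ∣                                     ∎
  where
  open ≡-Reasoning
  comb : Fin 7 → Subset k
  comb j = sumOver t (nonzero j)
  U = t 0F ∪ t 1F ∪ t 2F
  -- a nonzero vector of ℤ₂³ has odd dot product with exactly four of the seven nonzero vectors
  bits : ∀ a b c → ∑[ j < 7 ] ind (par (nonzero j ∩ (a ∷ b ∷ c ∷ []))) ≡ 4 * ind (a ∨ b ∨ c)
  bits true  true  true  = refl
  bits true  true  false = refl
  bits true  false true  = refl
  bits true  false false = refl
  bits false true  true  = refl
  bits false true  false = refl
  bits false false true  = refl
  bits false false false = refl
  elementwise : ∀ y → ∑[ j < 7 ] ind (lookup (comb j) y) ≡ 4 * ind (lookup U y)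
  elementwise y rewrite lookup-∪ (t 0F) (t 1F ∪ t 2F) y | lookup-∪ (t 1F) (t 2F) y =
    trans (sum-cong-≗ (λ j → cong ind (lookup-sumOver t (nonzero j) y)))
          (bits (lookup (t 0F) y) (lookup (t 1F) y) (lookup (t 2F) y))

-- The weights of the seven combinations

∑≡0⇒≡0 : (f : Fin m → ℕ) → ∑[ j < m ] f j ≡ 0 → ∀ j → f j ≡ 0
∑≡0⇒≡0 f ∑f≡0 zero    = m+n≡0⇒m≡0 (f zero) ∑f≡0
∑≡0⇒≡0 f ∑f≡0 (suc j) = ∑≡0⇒≡0 (f ∘ suc) (m+n≡0⇒n≡0 (f zero) ∑f≡0) j

∑≡1⇒single-one : (f : Fin m → ℕ) → ∑[ j < m ] f j ≡ 1 → ∃ λ i → f i ≡ 1 × (∀ j → j ≢ i → f j ≡ 0)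
∑≡1⇒single-one {zero}  f ()
∑≡1⇒single-one {suc m} f ∑f≡1 with f zero in f₀
... | 0 = let i , fᵢ≡1 , others = ∑≡1⇒single-one (f ∘ suc) ∑f≡1 in
  suc i , fᵢ≡1 , λ { zero _ → f₀ ; (suc j) j≢i → others j (j≢i ∘ cong suc) }
... | 1 = zero , f₀ , λ { zero 0≢0 → ⊥-elim (0≢0 refl) ; (suc j) _ → ∑≡0⇒≡0 (f ∘ suc) (suc-injective ∑f≡1) j }
... | suc (suc _) with () ← ∑f≡1

even≥6⇒excess : ∀ {w} → 6 ≤ w → parity w ≡ false → ∃ λ e → w ≡ 6 + 2 * e
even≥6⇒excess (s≤s (s≤s (s≤s (s≤s (s≤s (s≤s (z≤n {d}))))))) even =
  let e , d≡2e = parity⇒Even (trans (sym (not-involutive⁶ (parity d))) even) in e , cong (6 +_) d≡2e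
  where
  not-involutive⁶ : ∀ b → not (not (not (not (not (not b))))) ≡ b
  not-involutive⁶ true  = refl
  not-involutive⁶ false = refl

-- Writing W j = 6 + 2 e j, the total 42 + 2 ∑ e is a multiple of 4 and at most 44, so ∑ e = 1.
one-heavy-weight : ∀ {u} (W : Fin 7 → ℕ) → (∀ j → 6 ≤ W j) → (∀ j → parity (W j) ≡ false) →
  ∑[ j < 7 ] W j ≡ 4 * u → u ≤ 11 → ∃ λ i → W i ≡ 8 × (∀ j → j ≢ i → W j ≡ 6)
one-heavy-weight {u} W W≥6 W-even ∑W≡4u u≤11 =
  let i , eᵢ≡1 , others = ∑≡1⇒single-one e (42+2s≡4u⇒s≡1 (∑[ j < 7 ] e j) u ∑e-eq u≤11)
  in i , trans (W≡6+2e i) (cong (λ x → 6 + 2 * x) eᵢ≡1)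
       , λ j j≢i → trans (W≡6+2e j) (cong (λ x → 6 + 2 * x) (others j j≢i))
  where
  open ≡-Reasoning
  e : Fin 7 → ℕ
  e j = proj₁ (even≥6⇒excess (W≥6 j) (W-even j))
  W≡6+2e : ∀ j → W j ≡ 6 + 2 * e j
  W≡6+2e j = proj₂ (even≥6⇒excess (W≥6 j) (W-even j))
  ∑e-eq : 42 + 2 * ∑[ j < 7 ] e j ≡ 4 * u
  ∑e-eq = begin
    42 + 2 * ∑[ j < 7 ] e j             ≡⟨ cong (42 +_) (*-distribˡ-sum 2 e) ⟩
    42 + ∑[ j < 7 ] (2 * e j)           ≡⟨ ∑-distrib-+ (λ _ → 6) (λ j → 2 * e j) ⟨
    ∑[ j < 7 ] (6 + 2 * e j)            ≡⟨ sum-cong-≗ W≡6+2e ⟨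
    ∑[ j < 7 ] W j                      ≡⟨ ∑W≡4u ⟩
    4 * u                               ∎
  42+2s≡4u⇒s≡1 : ∀ s u → 42 + 2 * s ≡ 4 * u → u ≤ 11 → s ≡ 1
  42+2s≡4u⇒s≡1 s 11 eq _ = *-cancelˡ-≡ s 1 2 (+-cancelˡ-≡ 42 (2 * s) 2 eq)
  42+2s≡4u⇒s≡1 s 0  () _
  42+2s≡4u⇒s≡1 s 1  () _
  42+2s≡4u⇒s≡1 s 2  () _
  42+2s≡4u⇒s≡1 s 3  () _
  42+2s≡4u⇒s≡1 s 4  () _
  42+2s≡4u⇒s≡1 s 5  () _
  42+2s≡4u⇒s≡1 s 6  () _
  42+2s≡4u⇒s≡1 s 7  () _
  42+2s≡4u⇒s≡1 s 8  () _
  42+2s≡4u⇒s≡1 s 9  () _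
  42+2s≡4u⇒s≡1 s 10 () _
  42+2s≡4u⇒s≡1 s (suc (suc (suc (suc (suc (suc (suc (suc (suc (suc (suc (suc u))))))))))))
    _ (s≤s (s≤s (s≤s (s≤s (s≤s (s≤s (s≤s (s≤s (s≤s (s≤s (s≤s ())))))))))))

-- Eleven points spanning a seven-dimensional flat

triangular⇒combinations-nonempty : (t : Fin 3 → Subset k) {a₁ a₂ a₃ : Fin k} →
  a₁ ∈ t 0F → a₁ ∉ t 1F → a₁ ∉ t 2F → a₂ ∈ t 1F → a₂ ∉ t 2F → a₃ ∈ t 2F →
  ∀ j → ∃ λ y → y ∈ sumOver t (nonzero j)
triangular⇒combinations-nonempty t {a₁} {a₂} {a₃} a₁∈t₀ a₁∉t₁ a₁∉t₂ a₂∈t₁ a₂∉t₂ a₃∈t₂ = λ where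
    0F → a₁ , via (nonzero 0F) prof₁ refl
    1F → a₂ , via (nonzero 1F) prof₂ refl
    2F → a₃ , via (nonzero 2F) prof₃ refl
    3F → a₁ , via (nonzero 3F) prof₁ refl
    4F → a₁ , via (nonzero 4F) prof₁ refl
    5F → a₂ , via (nonzero 5F) prof₂ refl
    6F → a₁ , via (nonzero 6F) prof₁ refl
  where
  profile : Fin _ → Subset 3
  profile y = tabulate (λ i → lookup (t i) y)
  via : ∀ {y p} β → profile y ≡ p → par (β ∩ p) ≡ true → y ∈ sumOver t β
  via {y} β profile≡p par≡true =
    lookup⇒∈ (trans (lookup-sumOver t β y) (trans (cong (λ p → par (β ∩ p)) profile≡p) par≡true))
  prof₁ : profile a₁ ≡ true ∷ false ∷ false ∷ []
  prof₁ = cong₂ _∷_ (∈⇒lookup a₁∈t₀) (cong₂ _∷_ (∉⇒lookup a₁∉t₁) (cong (_∷ []) (∉⇒lookup a₁∉t₂)))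
  prof₂ : profile a₂ ≡ lookup (t 0F) a₂ ∷ true ∷ false ∷ []
  prof₂ = cong (lookup (t 0F) a₂ ∷_) (cong₂ _∷_ (∈⇒lookup a₂∈t₁) (cong (_∷ []) (∉⇒lookup a₂∉t₂)))
  prof₃ : profile a₃ ≡ lookup (t 0F) a₃ ∷ lookup (t 1F) a₃ ∷ true ∷ []
  prof₃ = cong (λ b → lookup (t 0F) a₃ ∷ lookup (t 1F) a₃ ∷ b ∷ []) (∈⇒lookup a₃∈t₂)

∣⊤-x∣≡10 : (x : Fin 11) → ∣ ⊤ - x ∣ ≡ 10
∣⊤-x∣≡10 x = ∣p-x∣≡ {x = x} {p = ⊤} ∈⊤ refl

module _ {n : ℕ} (S : Fin 11 → Point n) (P : Fin 8 → Point n)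
         (P-indep : AffIndep P ⊤) (P-span : SameAff P ⊤ S ⊤) where

  module Complement (x₁ x₂ x₃ : Fin 11) (x₂≢x₁ : x₂ ≢ x₁) (x₃≢x₁ : x₃ ≢ x₁) (x₃≢x₂ : x₃ ≢ x₂) where

    B : Subset 11
    B = ⊤ - x₁ - x₂ - x₃

    ∈B : ∀ {y} → y ≢ x₁ → y ≢ x₂ → y ≢ x₃ → y ∈ B
    ∈B y≢x₁ y≢x₂ y≢x₃ = x∈p∧x≢y⇒x∈p-y (x∈p∧x≢y⇒x∈p-y (x∈p∧x≢y⇒x∈p-y ∈⊤ y≢x₁) y≢x₂) y≢x₃

    ∈B⁻ : ∀ {y} → y ∈ B → y ≢ x₁ × y ≢ x₂ × y ≢ x₃
    ∈B⁻ y∈B = let y∈B₂ , y≢x₃ = ∈-remove⁻ y∈B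
                  y∈B₁ , y≢x₂ = ∈-remove⁻ y∈B₂
              in proj₂ (∈-remove⁻ y∈B₁) , y≢x₂ , y≢x₃

    x₁∉B : x₁ ∉ B
    x₁∉B x₁∈B = proj₁ (∈B⁻ x₁∈B) refl

    x₂∉B : x₂ ∉ B
    x₂∉B x₂∈B = proj₁ (proj₂ (∈B⁻ x₂∈B)) refl

    x₃∉B : x₃ ∉ B
    x₃∉B x₃∈B = proj₂ (proj₂ (∈B⁻ x₃∈B)) refl

    ∉B⁻ : ∀ y → y ∉ B → y ≡ x₁ ⊎ y ≡ x₂ ⊎ y ≡ x₃
    ∉B⁻ y y∉B with y ≟ x₁ | y ≟ x₂ | y ≟ x₃
    ... | yes y≡x₁ | _        | _        = inj₁ y≡x₁
    ... | no  _    | yes y≡x₂ | _        = inj₂ (inj₁ y≡x₂)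
    ... | no  _    | no  _    | yes y≡x₃ = inj₂ (inj₂ y≡x₃)
    ... | no y≢x₁  | no y≢x₂  | no y≢x₃  = ⊥-elim (y∉B (∈B y≢x₁ y≢x₂ y≢x₃))

    ∣B∣≡8 : ∣ B ∣ ≡ 8
    ∣B∣≡8 = ∣p-x∣≡ (x∈p∧x≢y⇒x∈p-y (x∈p∧x≢y⇒x∈p-y ∈⊤ x₃≢x₁) x₃≢x₂)
              (∣p-x∣≡ (x∈p∧x≢y⇒x∈p-y ∈⊤ x₂≢x₁) (∣⊤-x∣≡10 x₁))

    -- If S i lay in aff (B - i) then so would all of S, hence the 8 independent points P,
    -- although ∣ B - i ∣ = 7.
    independent : (∀ j → InAff S B (S j)) → AffIndep S B
    independent B-spans i i∈B Sᵢ∈aff = <-irrefl refl (subst (8 ≤_) ∣B-i∣≡7 8≤∣B-i∣)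
      where
      S⊆aff : ∀ m → InAff S (B - i) (S m)
      S⊆aff m = InAff-trans S-from-B-i (B-spans m)
        where
        S-from-B-i : ∀ j → j ∈ B → InAff S (B - i) (S j)
        S-from-B-i j j∈B with j ≟ i
        ... | yes refl = Sᵢ∈aff
        ... | no  j≢i  = InAff-∈ (x∈p∧x≢y⇒x∈p-y j∈B j≢i)
      8≤∣B-i∣ : 8 ≤ ∣ B - i ∣
      8≤∣B-i∣ = independent-span-bound P S (B - i) P-indep
                  (λ j → InAff-trans (λ m _ → S⊆aff m) (Equivalence.to (P-span (P j)) (InAff-∈ ∈⊤)))
      ∣B-i∣≡7 : ∣ B - i ∣ ≡ 7
      ∣B-i∣≡7 = ∣p-x∣≡ i∈B ∣B∣≡8

  module ExclusivePoints
    (C₁ C₂ C₃ : Subset 11) (rel₁ : AffineRelation S C₁) (rel₂ : AffineRelation S C₂) (rel₃ : AffineRelation S C₃)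
    (x₁ x₂ x₃ : Fin 11) (x₁∈C₁ : x₁ ∈ C₁) (x₂∈C₂ : x₂ ∈ C₂) (x₃∈C₃ : x₃ ∈ C₃)
    (x₁∉C₂ : x₁ ∉ C₂) (x₁∉C₃ : x₁ ∉ C₃) (x₂∉C₁ : x₂ ∉ C₁) (x₂∉C₃ : x₂ ∉ C₃) (x₃∉C₁ : x₃ ∉ C₁) (x₃∉C₂ : x₃ ∉ C₂)
    where

    open Complement x₁ x₂ x₃ (∈⇒≢ x₁∉C₂ x₂∈C₂) (∈⇒≢ x₁∉C₃ x₃∈C₃) (∈⇒≢ x₂∉C₃ x₃∈C₃) public

    C₁-x₁⊆B : C₁ - x₁ ⊆ B
    C₁-x₁⊆B y∈ = let y∈C₁ , y≢x₁ = ∈-remove⁻ y∈ in ∈B y≢x₁ (∈⇒≢ x₂∉C₁ y∈C₁) (∈⇒≢ x₃∉C₁ y∈C₁)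

    C₂-x₂⊆B : C₂ - x₂ ⊆ B
    C₂-x₂⊆B y∈ = let y∈C₂ , y≢x₂ = ∈-remove⁻ y∈ in ∈B (∈⇒≢ x₁∉C₂ y∈C₂) y≢x₂ (∈⇒≢ x₃∉C₂ y∈C₂)

    C₃-x₃⊆B : C₃ - x₃ ⊆ B
    C₃-x₃⊆B y∈ = let y∈C₃ , y≢x₃ = ∈-remove⁻ y∈ in ∈B (∈⇒≢ x₁∉C₃ y∈C₃) (∈⇒≢ x₂∉C₃ y∈C₃) y≢x₃

    Bx : {C : Subset 11} {x : Fin 11} → AffineRelation S C → x ∈ C → C - x ⊆ B → IsBx S B x (C - x)
    Bx rel x∈C C-x⊆B = let _ , _ , odd , sum = relation-remove rel x∈C in C-x⊆B , odd , sum

    spans : ∀ j → InAff S B (S j)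
    spans j with j ∈? B
    ... | yes j∈B = InAff-∈ j∈B
    ... | no  j∉B with ∉B⁻ j j∉B
    ...   | inj₁ refl        = InAff-mono C₁-x₁⊆B (relation-remove rel₁ x₁∈C₁)
    ...   | inj₂ (inj₁ refl) = InAff-mono C₂-x₂⊆B (relation-remove rel₂ x₂∈C₂)
    ...   | inj₂ (inj₂ refl) = InAff-mono C₃-x₃⊆B (relation-remove rel₃ x₃∈C₃)

    is-basis : IsBasis S B
    is-basis = independent spans , λ x → mk⇔ (InAff-mono (λ _ → ∈⊤)) (InAff-trans (λ j _ → spans j))

  basis-from-relations : (C₁ C₂ C₃ : Subset 11) →
    AffineRelation S C₁ → AffineRelation S C₂ → AffineRelation S C₃ →
    ∣ C₁ ∣ ≡ 6 → ∣ C₂ ∣ ≡ 6 → ∣ C₃ ∣ ≡ 6 → ∣ C₁ ⊕ C₂ ∣ ≡ 6 → ∣ C₁ ⊕ C₃ ∣ ≡ 6 → ∣ C₂ ⊕ C₃ ∣ ≡ 8 →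
    ∣ C₁ ⊕ C₂ ⊕ C₃ ∣ ≡ 6 → Σ _ λ B → IsBasis S B × HasExtType S B 5 5 5 3 3 2
  basis-from-relations C₁ C₂ C₃ rel₁ rel₂ rel₃ ∣C₁∣ ∣C₂∣ ∣C₃∣ ∣C₁₂∣ ∣C₁₃∣ ∣C₂₃∣ ∣C₁₂₃∣ =
    let x₁ , x₁∈C₁ , x₁∉C₂ , x₁∉C₃ = exclusive-element C₁ C₂ C₃
                                       (<-from-sizes ∣C₂∣ ∣C₃∣ ∣C₂₃∣ ∣C₁∣ ∣C₁₂∣ ∣C₁₃∣ ∣C₁₂₃∣ (m≤m+n 21 3))
        x₂ , x₂∈C₂ , x₂∉C₁ , x₂∉C₃ = exclusive-element C₂ C₁ C₃
                                       (<-from-sizes ∣C₁∣ ∣C₃∣ ∣C₁₃∣ ∣C₂∣ ∣C₂₁∣ ∣C₂₃∣ ∣C₂₁₃∣ (m≤m+n 19 7))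
        x₃ , x₃∈C₃ , x₃∉C₁ , x₃∉C₂ = exclusive-element C₃ C₁ C₂
                                       (<-from-sizes ∣C₁∣ ∣C₂∣ ∣C₁₂∣ ∣C₃∣ ∣C₃₁∣ ∣C₃₂∣ ∣C₃₁₂∣ (m≤m+n 19 7))
        open ExclusivePoints C₁ C₂ C₃ rel₁ rel₂ rel₃ x₁ x₂ x₃ x₁∈C₁ x₂∈C₂ x₃∈C₃ x₁∉C₂ x₁∉C₃ x₂∉C₁ x₂∉C₃ x₃∉C₁ x₃∉C₂
    in B , is-basis
     , x₁ , x₂ , x₃ , x₁∉B , x₂∉B , x₃∉B , ∈⇒≢ x₂∉C₁ x₁∈C₁ , ∈⇒≢ x₃∉C₁ x₁∈C₁ , ∈⇒≢ x₃∉C₂ x₂∈C₂ , ∉B⁻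
     , C₁ - x₁ , C₂ - x₂ , C₃ - x₃ , Bx rel₁ x₁∈C₁ C₁-x₁⊆B , Bx rel₂ x₂∈C₂ C₂-x₂⊆B , Bx rel₃ x₃∈C₃ C₃-x₃⊆B
     , ∣p-x∣≡ x₁∈C₁ ∣C₁∣ , ∣p-x∣≡ x₂∈C₂ ∣C₂∣ , ∣p-x∣≡ x₃∈C₃ ∣C₃∣
     , trans (cong ∣_∣ (∩-remove x₁∉C₂ x₂∉C₁)) (intersection-size C₁ C₂ ∣C₁∣ ∣C₂∣ ∣C₁₂∣ refl)
     , trans (cong ∣_∣ (∩-remove x₁∉C₃ x₃∉C₁)) (intersection-size C₁ C₃ ∣C₁∣ ∣C₃∣ ∣C₁₃∣ refl)
     , trans (cong ∣_∣ (∩-remove x₂∉C₃ x₃∉C₂)) (intersection-size C₂ C₃ ∣C₂∣ ∣C₃∣ ∣C₂₃∣ refl)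
    where
    ∣C₂₁∣ : ∣ C₂ ⊕ C₁ ∣ ≡ 6
    ∣C₂₁∣ = trans (cong ∣_∣ (⊕-comm C₂ C₁)) ∣C₁₂∣
    ∣C₃₁∣ : ∣ C₃ ⊕ C₁ ∣ ≡ 6
    ∣C₃₁∣ = trans (cong ∣_∣ (⊕-comm C₃ C₁)) ∣C₁₃∣
    ∣C₃₂∣ : ∣ C₃ ⊕ C₂ ∣ ≡ 8
    ∣C₃₂∣ = trans (cong ∣_∣ (⊕-comm C₃ C₂)) ∣C₂₃∣
    ∣C₂₁₃∣ : ∣ C₂ ⊕ C₁ ⊕ C₃ ∣ ≡ 6
    ∣C₂₁₃∣ = trans (cong (λ z → ∣ z ⊕ C₃ ∣) (⊕-comm C₂ C₁)) ∣C₁₂₃∣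
    ∣C₃₁₂∣ : ∣ C₃ ⊕ C₁ ⊕ C₂ ∣ ≡ 6
    ∣C₃₁₂∣ = trans (cong ∣_∣ (trans (⊕-assoc C₃ C₁ C₂) (⊕-comm C₃ (C₁ ⊕ C₂)))) ∣C₁₂₃∣
    <-from-sizes : ∀ {a b c d e f g a′ b′ c′ d′ e′ f′ g′} →
      a ≡ a′ → b ≡ b′ → c ≡ c′ → d ≡ d′ → e ≡ e′ → f ≡ f′ → g ≡ g′ →
      a′ + b′ + c′ < d′ + e′ + f′ + g′ → a + b + c < d + e + f + g
    <-from-sizes refl refl refl refl refl refl refl lt = lt

  basis-from-combinations : (t : Fin 3 → Subset 11) → (∀ i → AffineRelation S (t i)) → (f₁ f₂ f₃ : Subset 3) →
    ∣ sumOver t f₁ ∣ ≡ 6 → ∣ sumOver t f₂ ∣ ≡ 6 → ∣ sumOver t f₃ ∣ ≡ 6 →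
    ∣ sumOver t (f₁ ⊕ f₂) ∣ ≡ 6 → ∣ sumOver t (f₁ ⊕ f₃) ∣ ≡ 6 → ∣ sumOver t (f₂ ⊕ f₃) ∣ ≡ 8 →
    ∣ sumOver t (f₁ ⊕ f₂ ⊕ f₃) ∣ ≡ 6 → Σ _ λ B → IsBasis S B × HasExtType S B 5 5 5 3 3 2
  basis-from-combinations t rel f₁ f₂ f₃ w₁ w₂ w₃ w₁₂ w₁₃ w₂₃ w₁₂₃ =
    basis-from-relations (sumOver t f₁) (sumOver t f₂) (sumOver t f₃)
      (relation-sumOver t rel f₁) (relation-sumOver t rel f₂) (relation-sumOver t rel f₃) w₁ w₂ w₃
      (trans (cong ∣_∣ (sym (sumOver-⊕ t f₁ f₂))) w₁₂) (trans (cong ∣_∣ (sym (sumOver-⊕ t f₁ f₃))) w₁₃)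
      (trans (cong ∣_∣ (sym (sumOver-⊕ t f₂ f₃))) w₂₃)
      (trans (cong ∣_∣ (sym (trans (sumOver-⊕ t (f₁ ⊕ f₂) f₃) (cong (_⊕ sumOver t f₃) (sumOver-⊕ t f₁ f₂))))) w₁₂₃)

  basis-from-heavy-combination : (t : Fin 3 → Subset 11) → (∀ i → AffineRelation S (t i)) →
    (∃ λ i → ∣ sumOver t (nonzero i) ∣ ≡ 8 × (∀ j → j ≢ i → ∣ sumOver t (nonzero j) ∣ ≡ 6)) →
    Σ _ λ B → IsBasis S B × HasExtType S B 5 5 5 3 3 2
  -- In each case f₂ ⊕ f₃ is the heavy combination and f₁ lies outside the span of f₂ and f₃.
  basis-from-heavy-combination t rel (0F , heavy , light) =
    basis-from-combinations t rel (nonzero 2F) (nonzero 1F) (nonzero 3F)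
      (light 2F λ ()) (light 1F λ ()) (light 3F λ ()) (light 5F λ ()) (light 6F λ ()) heavy (light 4F λ ())
  basis-from-heavy-combination t rel (1F , heavy , light) =
    basis-from-combinations t rel (nonzero 2F) (nonzero 0F) (nonzero 3F)
      (light 2F λ ()) (light 0F λ ()) (light 3F λ ()) (light 4F λ ()) (light 6F λ ()) heavy (light 5F λ ())
  basis-from-heavy-combination t rel (2F , heavy , light) =
    basis-from-combinations t rel (nonzero 1F) (nonzero 0F) (nonzero 4F)
      (light 1F λ ()) (light 0F λ ()) (light 4F λ ()) (light 3F λ ()) (light 6F λ ()) heavy (light 5F λ ())
  basis-from-heavy-combination t rel (3F , heavy , light) =
    basis-from-combinations t rel (nonzero 2F) (nonzero 0F) (nonzero 1F)
      (light 2F λ ()) (light 0F λ ()) (light 1F λ ()) (light 4F λ ()) (light 5F λ ()) heavy (light 6F λ ())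
  basis-from-heavy-combination t rel (4F , heavy , light) =
    basis-from-combinations t rel (nonzero 1F) (nonzero 0F) (nonzero 2F)
      (light 1F λ ()) (light 0F λ ()) (light 2F λ ()) (light 3F λ ()) (light 5F λ ()) heavy (light 6F λ ())
  basis-from-heavy-combination t rel (5F , heavy , light) =
    basis-from-combinations t rel (nonzero 1F) (nonzero 0F) (nonzero 6F)
      (light 1F λ ()) (light 0F λ ()) (light 6F λ ()) (light 3F λ ()) (light 4F λ ()) heavy (light 2F λ ())
  basis-from-heavy-combination t rel (6F , heavy , light) =
    basis-from-combinations t rel (nonzero 1F) (nonzero 0F) (nonzero 5F)
      (light 1F λ ()) (light 0F λ ()) (light 5F λ ()) (light 3F λ ()) (light 2F λ ()) heavy (light 4F λ ())

  relation-inside : (R : Subset 11) → 8 < ∣ R ∣ → ∃₂ λ T a → AffineRelation S T × T ⊆ R × a ∈ T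
  relation-inside R = nonempty-relation-within S P ⊤ R (λ i → Equivalence.from (P-span (S i)) (InAff-∈ ∈⊤))

  independent-relations : Σ (Fin 3 → Subset 11) λ t →
    (∀ i → AffineRelation S (t i)) × (∀ j → ∃ λ y → y ∈ sumOver t (nonzero j))
  independent-relations
    with t₁ , a₁ , rel₁ , _     , a₁∈t₁ ← relation-inside ⊤ (m≤m+n 9 2)
    with t₂ , a₂ , rel₂ , t₂⊆R₁ , a₂∈t₂ ← relation-inside (⊤ - a₁) (subst (8 <_) (sym (∣⊤-x∣≡10 a₁)) (m≤m+n 9 1))
    with t₃ , a₃ , rel₃ , t₃⊆R₂ , a₃∈t₃ ← relation-inside (⊤ - a₁ - a₂)
                                             (subst (8 <_) (sym (∣p-x∣≡ (t₂⊆R₁ a₂∈t₂) (∣⊤-x∣≡10 a₁))) (m≤m+n 9 0))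
    = lookup (t₁ ∷ t₂ ∷ t₃ ∷ [])
    , (λ where 0F → rel₁ ; 1F → rel₂ ; 2F → rel₃)
    , triangular⇒combinations-nonempty (lookup (t₁ ∷ t₂ ∷ t₃ ∷ [])) a₁∈t₁
        (λ a₁∈t₂ → x∉p-x ⊤ a₁ (t₂⊆R₁ a₁∈t₂))
        (λ a₁∈t₃ → x∉p-x ⊤ a₁ (proj₁ (∈-remove⁻ (t₃⊆R₂ a₁∈t₃))))
        a₂∈t₂
        (λ a₂∈t₃ → x∉p-x (⊤ - a₁) a₂ (t₃⊆R₂ a₂∈t₃))
        a₃∈t₃

proposition6p8 : (n : ℕ) (S : Fin 11 → Point n) →
    Injective _≡_ _≡_ S → IsCap S → HasDim S 7 →
    Σ _ λ B → IsBasis S B × HasExtType S B 5 5 5 3 3 2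
proposition6p8 n S S-injective cap (P , _ , P-indep , P-span) =
  let t , rel , nonempty = independent-relations S P P-indep P-span
      W = λ j → ∣ sumOver t (nonzero j) ∣
  in basis-from-heavy-combination S P P-indep P-span t rel
       (one-heavy-weight W
         (λ j → relation-size≥6 S-injective cap (relation-sumOver t rel (nonzero j)) (proj₂ (nonempty j)))
         (λ j → trans (sym (par≡parity∣∣ (sumOver t (nonzero j)))) (proj₂ (relation-sumOver t rel (nonzero j))))
         (∑-nonzero-combinations t) (∣p∣≤n (t 0F ∪ t 1F ∪ t 2F)))
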